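{- Let $G$ be a finite $2$-connected outerplanar graph with nontrivial automorphism group. If $G$ contains a vertex $x$ that is moved by every reflection in $\mathrm{Aut}(G)$, then $\{x\}$ is a minimal determining set of $G$. If $G$ contains two vertices $u$ and $v$ that are fixed by different reflections in $\mathrm{Aut}(G)$, then $\{u,v\}$ is a minimal determining set of $G$. Moreover, every minimal determining set of $G$ is of one of these two forms.
   Context: A set $S\subseteq V(G)$ is a determining set if the only automorphism of $G$ fixing every vertex of $S$ is the identity; it is minimal if no proper subset is a determining set. A $2$-connected outerplanar graph with at least three vertices has a unique Hamilton cycle, which every automorphism preserves, so every automorphism acts on this cycle as a rotation or a reflection of the cycle; a reflection of $G$ means a nonidentity automorphism acting as a reflection of the Hamilton cycle. When $G=K_2$, its unique nontrivial automorphism is regarded as a reflection. -}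

module Defs where

open import Data.Nat using (ℕ; suc; _+_; _≤_)
open import Data.Fin using (Fin; toℕ; _<_)
open import Data.Fin.Subset using (Subset; _∈_; _⊂_; ⁅_⁆; _∪_)
open import Data.Bool using (Bool; true; false)
open import Data.Product using (Σ; ∃; ∃-syntax; _×_; _,_)
open import Data.Sum using (_⊎_)
open import Relation.Nullary using (¬_)
open import Relation.Binary.PropositionalEquality using (_≡_; _≢_)
open import Function.Definitions using (Injective)

record Graph (n : ℕ) : Set where
  field
    adj   : Fin n → Fin n → Bool
    sym   : ∀ i j → adj i j ≡ adj j i
    irrefl : ∀ i → adj i i ≡ false
open Graph public

-- Automorphisms: injective (hence bijective) maps Fin n → Fin n preserving
-- adjacency and non-adjacency.
IsAut : ∀ {n} → Graph n → (Fin n → Fin n) → Set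
IsAut G φ = Injective _≡_ _≡_ φ × (∀ i j → adj G (φ i) (φ j) ≡ adj G i j)

NonIdentity : ∀ {n} → (Fin n → Fin n) → Set
NonIdentity φ = ∃[ v ] φ v ≢ v

NontrivialAut : ∀ {n} → Graph n → Set
NontrivialAut G = ∃[ φ ] (IsAut G φ × NonIdentity φ)

-- G is 2-connected outerplanar, witnessed by its Hamilton cycle
-- σ 0, σ 1, ..., σ (n-1), σ 0 with all edges pairwise non-crossing
-- with respect to this cyclic order (i.e. an outerplane drawing with the
-- vertices on a circle in this order).  For n = 2 this is exactly K₂.
record OuterplanarHamiltonian {n : ℕ} (G : Graph n) (σ : Fin n → Fin n) : Set where
  field
    atLeastTwo : 2 ≤ n
    bij        : Injective _≡_ _≡_ σ
    cycle      : ∀ i j → (suc (toℕ i) ≡ toℕ j ⊎ (suc (toℕ i) ≡ n × toℕ j ≡ 0)) →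
                 adj G (σ i) (σ j) ≡ true
    noncrossing : ∀ a b c d → a < c → c < b → b < d →
                  adj G (σ a) (σ b) ≡ true → adj G (σ c) (σ d) ≡ false

-- A reflection: a nonidentity automorphism acting on the Hamilton cycle σ as
-- the reflection  position i ↦ position (k - i mod n).
IsReflection : ∀ {n} → Graph n → (Fin n → Fin n) → (Fin n → Fin n) → Set
IsReflection {n} G σ φ =
  IsAut G φ × NonIdentity φ ×
  (∃[ k ] (suc k ≤ n × (∀ i j → (toℕ i + toℕ j ≡ k ⊎ toℕ i + toℕ j ≡ k + n) →
                                  φ (σ i) ≡ σ j)))

Determining : ∀ {n} → Graph n → Subset n → Set
Determining G S = ∀ φ → IsAut G φ → (∀ v → v ∈ S → φ v ≡ v) → ∀ v → φ v ≡ v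

MinimalDetermining : ∀ {n} → Graph n → Subset n → Set
MinimalDetermining G S = Determining G S × (∀ T → T ⊂ S → ¬ Determining G T)

MovedByAllReflections : ∀ {n} → Graph n → (Fin n → Fin n) → Fin n → Set
MovedByAllReflections G σ x = ∀ φ → IsReflection G σ φ → φ x ≢ x

FixedByDifferentReflections : ∀ {n} → Graph n → (Fin n → Fin n) → Fin n → Fin n → Set
FixedByDifferentReflections G σ u v =
  u ≢ v × ∃[ φ ] ∃[ ψ ] (IsReflection G σ φ × IsReflection G σ ψ ×
                         (∃[ w ] φ w ≢ ψ w) × φ u ≡ u × ψ v ≡ v)

{-# OPTIONS --safe #-}
-- Read an automorphism φ on the positions of the Hamilton cycle.  It maps cycle edges to edges,
-- and cannot map a cycle edge onto a chord: the rest of the Hamilton cycle would be a path that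
-- avoids the chord, hence stays on one side of it, yet it visits both sides.  So φ maps cycle
-- edges to cycle edges and acts as a rotation or a reflection.  A rotation fixing a vertex is the
-- identity, and a reflection is determined by any vertex it fixes; so a nonidentity automorphism
-- fixing x is the unique reflection fixing x.  This gives both kinds of determining sets.
-- Conversely a minimal determining set S contains some x; if no reflection fixes x then {x} is
-- determining, and otherwise S contains a y moved by the reflection fixing x, and then either {y}
-- or {x, y} is determining, so by minimality it equals S.
module Submission where

open import Defs hiding (sym)
open import Data.Bool using (Bool; true; false)
open import Relation.Binary.Definitions using (tri<; tri≈; tri>)
import Data.Bool.Properties as Bool
open import Data.Nat as ℕ using (ℕ; zero; suc; _+_)
import Data.Nat.Properties as ℕ
open import Data.Nat.DivMod using (_%_; m%n<n; m<n⇒m%n≡m; n%n≡0)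
open import Data.Fin using (Fin; zero; suc; toℕ; fromℕ; fromℕ<; inject₁; punchOut; _≟_; _<_; _<?_)
open import Data.Fin.Properties
  using ( any?; all?; <-cmp; <-trans; <-asym; <⇒≢; ≤∧≢⇒<; toℕ-injective; toℕ-fromℕ<; toℕ<n; toℕ-fromℕ
        ; toℕ-inject₁; ≤fromℕ; injective⇒≤; punchOut-injective)
open import Data.Fin.Induction using (<-weakInduction; <-weakInduction-startingFrom)
open import Data.Product using (∃; ∃-syntax; Σ-syntax; _×_; _,_; proj₁; proj₂)
open import Data.Sum using (_⊎_; inj₁; inj₂; [_,_])
open import Data.Empty using (⊥; ⊥-elim)
open import Relation.Nullary using (¬_; Dec; yes; no; ¬?; _×-dec_; _→-dec_)
open import Relation.Nullary.Decidable using (map′; does; dec-true; dec-false)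
open import Data.Fin.Subset using (_∈_; _∉_; _⊂_; _⊆_; ⁅_⁆; _∪_)
open import Data.Fin.Subset.Properties using (_∈?_; x∈⁅x⁆; x∈⁅y⁆⇒x≡y; x∈p∪q⁻; x∈p∪q⁺; ⊆-antisym)
open import Relation.Binary.PropositionalEquality hiding ([_])
open ≡-Reasoning
open import Function using (_∘_; id)
open import Function.Definitions using (Injective)

injective⇒surjective : ∀ {n} (f : Fin n → Fin n) → Injective _≡_ _≡_ f → ∀ y → ∃[ x ] f x ≡ y
injective⇒surjective {zero}  f f-inj ()
injective⇒surjective {suc n} f f-inj y with any? (λ x → f x ≟ y)
... | yes hit = hit
... | no miss = ⊥-elim (ℕ.1+n≰n (injective⇒≤ g-injective))
  where
  -- f misses y, so f injects Fin (suc n) into Fin (suc n) ∖ {y} ≅ Fin n.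
  g : Fin (suc n) → Fin n
  g x = punchOut {i = y} λ y≡fx → miss (x , sym y≡fx)
  g-injective : Injective _≡_ _≡_ g
  g-injective {a} {b} = f-inj ∘ punchOut-injective (λ e → miss (a , sym e)) (λ e → miss (b , sym e))

cons : ∀ {m n} → Fin n → (Fin m → Fin n) → Fin (suc m) → Fin n
cons a g zero    = a
cons a g (suc i) = g i

cons-cong : ∀ {m n} {a : Fin n} {g h : Fin m → Fin n} → (∀ i → g i ≡ h i) → ∀ i → cons a g i ≡ cons a h i
cons-cong g≗h zero    = refl
cons-cong g≗h (suc i) = g≗h i

cons-η : ∀ {m n} (f : Fin (suc m) → Fin n) → ∀ i → f i ≡ cons (f zero) (f ∘ suc) i
cons-η f zero    = refl
cons-η f (suc i) = refl

∃-function? : ∀ m n (P : (Fin m → Fin n) → Set) → (∀ f → Dec (P f)) →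
              (∀ f g → (∀ i → f i ≡ g i) → P f → P g) → Dec (∃ P)
∃-function? zero n P P? ext with P? (λ ())
... | yes p = yes (_ , p)
... | no ¬p = no λ (f , pf) → ¬p (ext f _ (λ ()) pf)
∃-function? (suc m) n P P? ext
  with any? (λ a → ∃-function? m n (P ∘ cons a) (P? ∘ cons a) (λ g h → ext _ _ ∘ cons-cong))
... | yes (a , g , p) = yes (cons a g , p)
... | no ¬p = no λ (f , pf) → ¬p (f zero , f ∘ suc , ext f _ (cons-η f) pf)

⁅⁆⊆ : ∀ {n} {x : Fin n} {S} → x ∈ S → ⁅ x ⁆ ⊆ S
⁅⁆⊆ {x = x} x∈S y∈⁅x⁆ = subst (_∈ _) (sym (x∈⁅y⁆⇒x≡y x y∈⁅x⁆)) x∈S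

⁅⁆∪⁅⁆⊆ : ∀ {n} {x y : Fin n} {S} → x ∈ S → y ∈ S → ⁅ x ⁆ ∪ ⁅ y ⁆ ⊆ S
⁅⁆∪⁅⁆⊆ {x = x} {y} x∈S y∈S z∈ = [ ⁅⁆⊆ x∈S , ⁅⁆⊆ y∈S ] (x∈p∪q⁻ ⁅ x ⁆ ⁅ y ⁆ z∈)

∈⁅⁆-unique : ∀ {n} {w y z : Fin n} → y ∈ ⁅ w ⁆ → z ∈ ⁅ w ⁆ → y ≡ z
∈⁅⁆-unique {w = w} y∈ z∈ = trans (x∈⁅y⁆⇒x≡y w y∈) (sym (x∈⁅y⁆⇒x≡y w z∈))

∉-⁅⁆ : ∀ {n} {w y t : Fin n} {T} → y ∉ T → y ∈ ⁅ w ⁆ → t ∈ ⁅ w ⁆ → t ∉ T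
∉-⁅⁆ {T = T} y∉T y∈ t∈ = y∉T ∘ subst (_∈ T) (∈⁅⁆-unique t∈ y∈)

⊂⁅⁆⇒empty : ∀ {n} {x : Fin n} {T} → T ⊂ ⁅ x ⁆ → ∀ v → v ∉ T
⊂⁅⁆⇒empty (T⊆ , y , y∈ , y∉T) v v∈T = ∉-⁅⁆ y∉T y∈ (T⊆ v∈T) v∈T

⊂⁅⁆∪⁅⁆ : ∀ {n} {u v : Fin n} {T} → T ⊂ ⁅ u ⁆ ∪ ⁅ v ⁆ → T ⊆ ⁅ u ⁆ ⊎ T ⊆ ⁅ v ⁆
⊂⁅⁆∪⁅⁆ {u = u} {v} {T} (T⊆ , y , y∈ , y∉T) with x∈p∪q⁻ ⁅ u ⁆ ⁅ v ⁆ y∈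
... | inj₁ y∈⁅u⁆ = inj₂ λ t∈T →
  [ (λ t∈⁅u⁆ → ⊥-elim (∉-⁅⁆ y∉T y∈⁅u⁆ t∈⁅u⁆ t∈T)) , id ] (x∈p∪q⁻ ⁅ u ⁆ ⁅ v ⁆ (T⊆ t∈T))
... | inj₂ y∈⁅v⁆ = inj₁ λ t∈T →
  [ id , (λ t∈⁅v⁆ → ⊥-elim (∉-⁅⁆ y∉T y∈⁅v⁆ t∈⁅v⁆ t∈T)) ] (x∈p∪q⁻ ⁅ u ⁆ ⁅ v ⁆ (T⊆ t∈T))

fixes-⊆⁅⁆ : ∀ {n} {φ : Fin n → Fin n} {u T} → φ u ≡ u → T ⊆ ⁅ u ⁆ → ∀ t → t ∈ T → φ t ≡ t
fixes-⊆⁅⁆ {φ = φ} {u} φu≡u T⊆ t t∈T = subst (λ z → φ z ≡ z) (sym (x∈⁅y⁆⇒x≡y u (T⊆ t∈T))) φu≡u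

true≢false : true ≢ false
true≢false ()

module Cyclic (k : ℕ) where

  n : ℕ
  n = suc k

  next : Fin n → Fin n
  next i = fromℕ< (m%n<n (suc (toℕ i)) n)

  next-cases : ∀ i → (suc (toℕ i) ℕ.< n × toℕ (next i) ≡ suc (toℕ i))
                   ⊎ (suc (toℕ i) ≡ n × toℕ (next i) ≡ 0)
  next-cases i with suc (toℕ i) ℕ.<? n
  ... | yes lt = inj₁ (lt , trans (toℕ-fromℕ< _) (m<n⇒m%n≡m lt))
  ... | no ≮n = inj₂ (last , trans (toℕ-fromℕ< _) (trans (cong (_% n) last) (n%n≡0 n)))
    where
    last : suc (toℕ i) ≡ n
    last = ℕ.≤-antisym (toℕ<n i) (ℕ.≮⇒≥ ≮n)

  next-injective : ∀ {i j} → next i ≡ next j → i ≡ j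
  next-injective {i} {j} e with next-cases i | next-cases j | cong toℕ e
  ... | inj₁ (_ , a) | inj₁ (_ , b) | e′ = toℕ-injective (ℕ.suc-injective (trans (sym a) (trans e′ b)))
  ... | inj₁ (_ , a) | inj₂ (_ , b) | e′ with () ← trans (sym a) (trans e′ b)
  ... | inj₂ (_ , a) | inj₁ (_ , b) | e′ with () ← trans (sym b) (trans (sym e′) a)
  ... | inj₂ (a , _) | inj₂ (b , _) | _  = toℕ-injective (ℕ.suc-injective (trans a (sym b)))

  next-inject₁ : ∀ (j : Fin k) → next (inject₁ j) ≡ suc j
  next-inject₁ j with next-cases (inject₁ j)
  ... | inj₁ (_ , a) = toℕ-injective (trans a (cong suc (toℕ-inject₁ j)))
  ... | inj₂ (c , _) = ⊥-elim (ℕ.<⇒≢ (toℕ<n j) (trans (sym (toℕ-inject₁ j)) (ℕ.suc-injective c)))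

  next-fromℕ : next (fromℕ k) ≡ zero
  next-fromℕ with next-cases (fromℕ k)
  ... | inj₁ (lt , _) = ⊥-elim (ℕ.<⇒≢ lt (cong suc (toℕ-fromℕ k)))
  ... | inj₂ (_ , b) = toℕ-injective b

  cyclic-induction : (P : Fin n → Set) → (∀ i → P i → P (next i)) → ∀ p → P p → ∀ i → P i
  cyclic-induction P step p Pp = <-weakInduction P P₀ step′
    where
    step′ : ∀ j → P (inject₁ j) → P (suc j)
    step′ j = subst P (next-inject₁ j) ∘ step (inject₁ j)
    P₀ : P zero
    P₀ = subst P next-fromℕ (step _ (<-weakInduction-startingFrom P Pp step′ (≤fromℕ p)))

  next²-fixed⇒k≤1 : ∀ i → next (next i) ≡ i → k ≡ 0 ⊎ k ≡ 1
  next²-fixed⇒k≤1 i e with next-cases i | next-cases (next i)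
  ... | inj₁ (_ , a) | inj₁ (_ , b)
    with () ← ℕ.<⇒≢ (ℕ.m<n⇒m<1+n (ℕ.n<1+n _)) (trans (sym (cong toℕ e)) (trans b (cong suc a)))
  ... | inj₁ (_ , a) | inj₂ (c , b) = inj₂ (ℕ.suc-injective (trans (sym c) (cong suc (trans a (cong suc (trans (sym (cong toℕ e)) b))))))
  ... | inj₂ (c , a) | inj₁ (_ , b) = inj₂ (ℕ.suc-injective (trans (sym c) (cong suc (trans (sym (cong toℕ e)) (trans b (cong suc a))))))
  ... | inj₂ (c , a) | inj₂ (d , b) = inj₁ (ℕ.suc-injective (trans (sym d) (cong suc a)))

  next²-fixed⇒involutive : ∀ i → next (next i) ≡ i → ∀ j → next (next j) ≡ j
  next²-fixed⇒involutive i e with next²-fixed⇒k≤1 i e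
  ... | inj₁ refl = λ { zero → refl }
  ... | inj₂ refl = λ { zero → refl ; (suc zero) → refl }

  Rotation Reflection : (Fin n → Fin n) → Set
  Rotation π   = ∀ i → π (next i) ≡ next (π i)
  Reflection π = ∀ i → next (π (next i)) ≡ π i

  -- A change of direction between i and next i forces next (next i) ≡ i, i.e. n ≤ 2,
  -- where rotations and reflections coincide.
  rotation-or-reflection : (π : Fin n → Fin n) → Injective _≡_ _≡_ π →
                           (∀ i → π (next i) ≡ next (π i) ⊎ next (π (next i)) ≡ π i) →
                           Rotation π ⊎ Reflection π
  rotation-or-reflection π π-inj local with local zero
  ... | inj₁ r = inj₁ (cyclic-induction _ forward zero r)
    where
    forward : ∀ i → π (next i) ≡ next (π i) → π (next (next i)) ≡ next (π (next i))
    forward i r with local (next i)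
    ... | inj₁ r′ = r′
    ... | inj₂ l  = trans (cong π flip) (trans (sym (next²-fixed⇒involutive _ flip (π i))) (cong next (sym r)))
      where
      flip : next (next i) ≡ i
      flip = π-inj (next-injective (trans l r))
  ... | inj₂ l = inj₂ (cyclic-induction _ backward zero l)
    where
    backward : ∀ i → next (π (next i)) ≡ π i → next (π (next (next i))) ≡ π (next i)
    backward i l with local (next i)
    ... | inj₂ l′ = l′
    ... | inj₁ r  = trans (cong (next ∘ π) flip) (trans (cong next (sym l)) (next²-fixed⇒involutive _ flip (π (next i))))
      where
      flip : next (next i) ≡ i
      flip = π-inj (trans r l)

  rotation-fixing-point⇒identity : ∀ {π} → Rotation π → ∀ p → π p ≡ p → ∀ i → π i ≡ i
  rotation-fixing-point⇒identity {π} rot =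
    cyclic-induction (λ i → π i ≡ i) λ i πi≡i → trans (rot i) (cong next πi≡i)

  reflections-agreeing-at-point-agree : ∀ {π π′} → Reflection π → Reflection π′ →
                                        ∀ p → π p ≡ π′ p → ∀ i → π i ≡ π′ i
  reflections-agreeing-at-point-agree {π} {π′} ref ref′ =
    cyclic-induction (λ i → π i ≡ π′ i) λ i e → next-injective (trans (ref i) (trans e (sym (ref′ i))))

  SumsTo : ℕ → Fin n → Fin n → Set
  SumsTo k₀ i j = toℕ i + toℕ j ≡ k₀ ⊎ toℕ i + toℕ j ≡ k₀ + n

  wrap-too-large : ∀ {t x y k₀} → t + x ≡ k₀ → t + y ≡ k₀ + n → ¬ y ℕ.< n
  wrap-too-large {t} {x} {y} refl b y<n = ℕ.m+n≮n x n (subst (ℕ._< n) y≡x+n y<n)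
    where
    y≡x+n : y ≡ x + n
    y≡x+n = ℕ.+-cancelˡ-≡ t y (x + n) (trans b (ℕ.+-assoc t x n))

  SumsTo-functional : ∀ {k₀ i j j′} → SumsTo k₀ i j → SumsTo k₀ i j′ → j ≡ j′
  SumsTo-functional {i = i} (inj₁ a) (inj₁ b) = toℕ-injective (ℕ.+-cancelˡ-≡ (toℕ i) _ _ (trans a (sym b)))
  SumsTo-functional {i = i} (inj₂ a) (inj₂ b) = toℕ-injective (ℕ.+-cancelˡ-≡ (toℕ i) _ _ (trans a (sym b)))
  SumsTo-functional {j′ = j′} (inj₁ a) (inj₂ b) = ⊥-elim (wrap-too-large a b (toℕ<n j′))
  SumsTo-functional {j = j}   (inj₂ a) (inj₁ b) = ⊥-elim (wrap-too-large b a (toℕ<n j))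

  reflection-sum : ∀ {π} → Reflection π → ∀ i → SumsTo (toℕ (π zero)) i (π i)
  reflection-sum {π} ref = <-weakInduction (λ i → SumsTo k₀ i (π i)) (inj₁ refl) step
    where
    k₀ = toℕ (π zero)
    ref-suc : ∀ j → next (π (suc j)) ≡ π (inject₁ j)
    ref-suc j = subst (λ s → next (π s) ≡ π (inject₁ j)) (next-inject₁ j) (ref (inject₁ j))
    step : ∀ j → SumsTo k₀ (inject₁ j) (π (inject₁ j)) → SumsTo k₀ (suc j) (π (suc j))
    step j sum with next-cases (π (suc j))
    ... | inj₁ (_ , a) = subst (λ s → s ≡ k₀ ⊎ s ≡ k₀ + n) same-sum sum
      where
      same-sum : toℕ (inject₁ j) + toℕ (π (inject₁ j)) ≡ toℕ (suc j) + toℕ (π (suc j))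
      same-sum = begin
        toℕ (inject₁ j) + toℕ (π (inject₁ j)) ≡⟨ cong₂ _+_ (toℕ-inject₁ j) (trans (cong toℕ (sym (ref-suc j))) a) ⟩
        toℕ j + suc (toℕ (π (suc j)))          ≡⟨ ℕ.+-suc _ _ ⟩
        toℕ (suc j) + toℕ (π (suc j))          ∎
    ... | inj₂ (c , b) = inj₂ (begin
        suc (toℕ j) + toℕ (π (suc j)) ≡⟨ ℕ.+-suc _ _ ⟨
        toℕ j + suc (toℕ (π (suc j))) ≡⟨ cong₂ _+_ j≡k₀ c ⟩
        k₀ + n                         ∎)
      where
      sum≡j : toℕ (inject₁ j) + toℕ (π (inject₁ j)) ≡ toℕ j
      sum≡j = trans (cong₂ _+_ (toℕ-inject₁ j) (trans (cong toℕ (sym (ref-suc j))) b)) (ℕ.+-identityʳ _)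
      j≡k₀ : toℕ j ≡ k₀
      j≡k₀ = [ trans (sym sum≡j)
             , (λ h → ⊥-elim (wrap-too-large {t = 0} refl (trans (sym sum≡j) h) (ℕ.m<n⇒m<1+n (toℕ<n j)))) ] sum

module _ {n : ℕ} (G : Graph n) where

  IsAut? : ∀ φ → Dec (IsAut G φ)
  IsAut? φ = injective? ×-dec all? λ i → all? λ j → adj G (φ i) (φ j) Bool.≟ adj G i j
    where
    injective? : Dec (Injective _≡_ _≡_ φ)
    injective? = map′ (λ inj {a} {b} → inj a b) (λ inj a b → inj)
                      (all? λ a → all? λ b → (φ a ≟ φ b) →-dec (a ≟ b))

  FixingAut : Fin n → (Fin n → Fin n) → Set
  FixingAut x φ = IsAut G φ × NonIdentity φ × φ x ≡ x

  ∃FixingAut? : ∀ x → Dec (∃ (FixingAut x))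
  ∃FixingAut? x = ∃-function? n n (FixingAut x) FixingAut? respects-≗
    where
    FixingAut? : ∀ φ → Dec (FixingAut x φ)
    FixingAut? φ = IsAut? φ ×-dec any? (λ v → ¬? (φ v ≟ v)) ×-dec (φ x ≟ x)
    respects-≗ : ∀ φ ψ → (∀ i → φ i ≡ ψ i) → FixingAut x φ → FixingAut x ψ
    respects-≗ φ ψ φ≗ψ ((inj , pres) , (v , φv≢v) , φx≡x) =
      ( (λ {a} {b} e → inj (trans (φ≗ψ a) (trans e (sym (φ≗ψ b)))))
      , (λ i j → trans (sym (cong₂ (adj G) (φ≗ψ i) (φ≗ψ j))) (pres i j)) )
      , (v , λ ψv≡v → φv≢v (trans (φ≗ψ v) ψv≡v))
      , trans (sym (φ≗ψ x)) φx≡x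

  nonidentity-fixing⇒¬Determining : ∀ {T φ} → IsAut G φ → NonIdentity φ →
                                    (∀ v → v ∈ T → φ v ≡ v) → ¬ Determining G T
  nonidentity-fixing⇒¬Determining aut (v , φv≢v) fixes det = φv≢v (det _ aut fixes v)

  Determining⇒moved-member : ∀ {S φ} → Determining G S → IsAut G φ → NonIdentity φ →
                             ∃[ y ] y ∈ S × φ y ≢ y
  Determining⇒moved-member {S} {φ} det aut nonid with any? (λ y → (y ∈? S) ×-dec ¬? (φ y ≟ y))
  ... | yes moved = moved
  ... | no ¬moved = ⊥-elim (nonidentity-fixing⇒¬Determining aut nonid fixes det)
    where
    fixes : ∀ v → v ∈ S → φ v ≡ v
    fixes v v∈S with φ v ≟ v
    ... | yes φv≡v = φv≡v
    ... | no φv≢v  = ⊥-elim (¬moved (v , v∈S , φv≢v))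

  minimal-determining-⊇⇒≡ : ∀ {S T} → MinimalDetermining G S → T ⊆ S → Determining G T → S ≡ T
  minimal-determining-⊇⇒≡ {S} {T} (_ , minimal) T⊆S det = ⊆-antisym S⊆T T⊆S
    where
    S⊆T : S ⊆ T
    S⊆T {z} z∈S with z ∈? T
    ... | yes z∈T = z∈T
    ... | no z∉T  = ⊥-elim (minimal T (T⊆S , z , z∈S , z∉T) det)

module Outerplanar {m} {G : Graph (suc (suc m))} {σ} (H : OuterplanarHamiltonian G σ) where
  open Cyclic (suc m)
  open OuterplanarHamiltonian H

  position : Fin n → Fin n
  position y = proj₁ (injective⇒surjective σ bij y)

  σ-position : ∀ y → σ (position y) ≡ y
  σ-position y = proj₂ (injective⇒surjective σ bij y)

  cycle-edge : ∀ i → adj G (σ i) (σ (next i)) ≡ true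
  cycle-edge i with next-cases i
  ... | inj₁ (_ , a) = cycle i (next i) (inj₁ (sym a))
  ... | inj₂ wraps   = cycle i (next i) (inj₂ wraps)

  chord-separates : ∀ {lo hi c d} → adj G (σ lo) (σ hi) ≡ true → lo < c → c < hi →
                    d < lo ⊎ hi < d → adj G (σ c) (σ d) ≡ false
  chord-separates chord lo<c c<hi (inj₂ hi<d) = noncrossing _ _ _ _ lo<c c<hi hi<d chord
  chord-separates {lo} {hi} {c} {d} chord lo<c c<hi (inj₁ d<lo) with adj G (σ c) (σ d) in cd
  ... | false = refl
  ... | true  = ⊥-elim (true≢false (trans (sym chord) (noncrossing d c lo hi d<lo lo<c c<hi dc)))
    where
    dc : adj G (σ d) (σ c) ≡ true
    dc = trans (Graph.sym G _ _) cd

  module CycleMap (π : Fin n → Fin n) (π-injective : Injective _≡_ _≡_ π)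
                  (π-edge : ∀ j → adj G (σ (π j)) (σ (π (next j))) ≡ true) where

    module CycleEdgeOntoChord (i lo hi : Fin n) (lo<hi : lo < hi) (chord : adj G (σ lo) (σ hi) ≡ true)
                 (hi≢next-lo : hi ≢ next lo) (next-hi≢lo : next hi ≢ lo)
                 (ends : (π i ≡ lo × π (next i) ≡ hi) ⊎ (π i ≡ hi × π (next i) ≡ lo)) where

      Between : Fin n → Set
      Between x = lo < x × x < hi

      Between? : ∀ x → Dec (Between x)
      Between? x = (lo <? x) ×-dec (x <? hi)

      inside : Fin n → Bool
      inside x = does (Between? x)

      NotEnd : Fin n → Set
      NotEnd x = x ≢ lo × x ≢ hi

      between⇒NotEnd : ∀ {x} → Between x → NotEnd x
      between⇒NotEnd (lo<x , x<hi) = (<⇒≢ lo<x ∘ sym) , <⇒≢ x<hi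

      outside⇒NotEnd : ∀ {x} → x < lo ⊎ hi < x → NotEnd x
      outside⇒NotEnd (inj₁ x<lo) = <⇒≢ x<lo , <⇒≢ (<-trans x<lo lo<hi)
      outside⇒NotEnd (inj₂ hi<x) = (<⇒≢ (<-trans lo<hi hi<x) ∘ sym) , (<⇒≢ hi<x ∘ sym)

      inside-true : ∀ {x} → inside x ≡ true → Between x
      inside-true {x} eq with Between? x
      ... | yes between = between
      ... | no ¬between = ⊥-elim (true≢false (trans (sym eq) (dec-false (Between? x) ¬between)))

      inside-false : ∀ {x} → inside x ≡ false → NotEnd x → x < lo ⊎ hi < x
      inside-false {x} eq (x≢lo , x≢hi) with x <? lo
      ... | yes x<lo = inj₁ x<lo
      ... | no x≮lo  = inj₂ (≤∧≢⇒< (ℕ.≮⇒≥ (¬between ∘ (lo<x ,_))) (x≢hi ∘ sym))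
        where
        lo<x : lo < x
        lo<x = ≤∧≢⇒< (ℕ.≮⇒≥ x≮lo) (x≢lo ∘ sym)
        ¬between : ¬ Between x
        ¬between b = true≢false (trans (sym (dec-true (Between? x) b)) eq)

      separated : ∀ {x y} → inside x ≡ true → inside y ≡ false → NotEnd y → adj G (σ x) (σ y) ≡ false
      separated ex ey y-ne = chord-separates chord (proj₁ (inside-true ex)) (proj₂ (inside-true ex)) (inside-false ey y-ne)

      same-side : ∀ {x y} → NotEnd x → NotEnd y → adj G (σ x) (σ y) ≡ true → inside x ≡ inside y
      same-side {x} {y} x-ne y-ne xy with inside x in ex | inside y in ey
      ... | true  | true  = refl
      ... | false | false = refl
      ... | true  | false = ⊥-elim (true≢false (trans (sym xy) (separated ex ey y-ne)))
      ... | false | true  = ⊥-elim (true≢false (trans (sym (trans (Graph.sym G _ _) xy)) (separated ey ex x-ne)))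

      ends⇒positions : ∀ {j} → π j ≡ lo ⊎ π j ≡ hi → j ≡ i ⊎ j ≡ next i
      ends⇒positions (inj₁ πj≡lo) =
        [ (λ (πi≡lo , _) → inj₁ (π-injective (trans πj≡lo (sym πi≡lo))))
        , (λ (_ , πnext-i≡lo) → inj₂ (π-injective (trans πj≡lo (sym πnext-i≡lo)))) ] ends
      ends⇒positions (inj₂ πj≡hi) =
        [ (λ (_ , πnext-i≡hi) → inj₂ (π-injective (trans πj≡hi (sym πnext-i≡hi))))
        , (λ (πi≡hi , _) → inj₁ (π-injective (trans πj≡hi (sym πi≡hi)))) ] ends

      positions⇒ends : ∀ {j} → j ≡ i ⊎ j ≡ next i → π j ≡ lo ⊎ π j ≡ hi
      positions⇒ends (inj₁ refl) = [ inj₁ ∘ proj₁ , inj₂ ∘ proj₁ ] ends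
      positions⇒ends (inj₂ refl) = [ inj₂ ∘ proj₂ , inj₁ ∘ proj₂ ] ends

      off-edge⇒NotEnd : ∀ {j} → j ≢ i → j ≢ next i → NotEnd (π j)
      off-edge⇒NotEnd j≢i j≢next-i =
        (λ e → [ j≢i , j≢next-i ] (ends⇒positions (inj₁ e))) ,
        (λ e → [ j≢i , j≢next-i ] (ends⇒positions (inj₂ e)))

      -- The rest of the Hamilton cycle, next i → next (next i) → ⋯ → i, avoids the chord and so
      -- stays on the side of π (next (next i)).
      side : Bool
      side = inside (π (next (next i)))

      Reached : Fin n → Set
      Reached j = j ≡ i ⊎ j ≡ next i ⊎ inside (π j) ≡ side

      walk : ∀ j → Reached j → Reached (next j)
      walk j (inj₁ refl)        = inj₂ (inj₁ refl)
      walk j (inj₂ (inj₁ refl)) = inj₂ (inj₂ refl)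
      walk j (inj₂ (inj₂ on-side)) with j ≟ i | j ≟ next i | next j ≟ i
      ... | yes refl | _        | _            = inj₂ (inj₁ refl)
      ... | _        | yes refl | _            = inj₂ (inj₂ refl)
      ... | _        | _        | yes next-j≡i = inj₁ next-j≡i
      ... | no j≢i   | no j≢next-i | no next-j≢i =
        inj₂ (inj₂ (trans (sym (same-side (off-edge⇒NotEnd j≢i j≢next-i)
                                          (off-edge⇒NotEnd next-j≢i (j≢i ∘ next-injective))
                                          (π-edge j)))
                          on-side))

      NotEnd⇒side : ∀ {x} → NotEnd x → inside x ≡ side
      NotEnd⇒side {x} (x≢lo , x≢hi) with injective⇒surjective π π-injective x
      ... | j , refl with cyclic-induction Reached walk i (inj₁ refl) j
      ...   | inj₂ (inj₂ on-side) = on-side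
      ...   | inj₁ j≡i             = ⊥-elim ([ x≢lo , x≢hi ] (positions⇒ends (inj₁ j≡i)))
      ...   | inj₂ (inj₁ j≡next-i) = ⊥-elim ([ x≢lo , x≢hi ] (positions⇒ends (inj₂ j≡next-i)))

      next-lo-between : Between (next lo)
      next-lo-between with next-cases lo
      ... | inj₁ (_ , a) = lo<next-lo , ≤∧≢⇒< (subst (ℕ._≤ toℕ hi) (sym a) lo<hi) (hi≢next-lo ∘ sym)
        where
        lo<next-lo : lo < next lo
        lo<next-lo = subst (toℕ lo ℕ.<_) (sym a) ℕ.≤-refl
      ... | inj₂ (wraps , _) = ⊥-elim (ℕ.<⇒≢ (ℕ.≤-<-trans lo<hi (toℕ<n hi)) wraps)

      outside-point : Σ[ d ∈ Fin n ] (d < lo ⊎ hi < d)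
      outside-point with lo ≟ zero
      ... | no lo≢0  = zero , inj₁ (≤∧≢⇒< ℕ.z≤n (lo≢0 ∘ sym))
      ... | yes refl = fromℕ (suc m) , inj₂ (≤∧≢⇒< (≤fromℕ hi) hi≢last)
        where
        hi≢last : hi ≢ fromℕ (suc m)
        hi≢last hi≡last = next-hi≢lo (trans (cong next hi≡last) next-fromℕ)

      impossible : ⊥
      impossible = true≢false (begin
        true                        ≡⟨ dec-true (Between? (next lo)) next-lo-between ⟨
        inside (next lo)            ≡⟨ NotEnd⇒side (between⇒NotEnd next-lo-between) ⟩
        side                        ≡⟨ NotEnd⇒side (outside⇒NotEnd d-outside) ⟨
        inside d                    ≡⟨ dec-false (Between? d) (λ (lo<d , d<hi) → [ <-asym lo<d , <-asym d<hi ] d-outside) ⟩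
        false                       ∎)
        where
        d = proj₁ outside-point
        d-outside = proj₂ outside-point

    image-of-next : ∀ i → π (next i) ≡ next (π i) ⊎ next (π (next i)) ≡ π i
    image-of-next i with π (next i) ≟ next (π i) | next (π (next i)) ≟ π i
    ... | yes forward | _        = inj₁ forward
    ... | no _        | yes back = inj₂ back
    ... | no ¬forward | no ¬back with <-cmp (π i) (π (next i))
    ...   | tri< lt _ _ = ⊥-elim (CycleEdgeOntoChord.impossible i (π i) (π (next i)) lt (π-edge i)
                                                               ¬forward ¬back (inj₁ (refl , refl)))
    ...   | tri> _ _ gt = ⊥-elim (CycleEdgeOntoChord.impossible i (π (next i)) (π i) gt (trans (Graph.sym G _ _) (π-edge i))
                                                   (¬back ∘ sym) (¬forward ∘ sym) (inj₂ (refl , refl)))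
    ...   | tri≈ _ eq _ = ⊥-elim (true≢false (trans (sym (π-edge i)) loop))
      where
      loop : adj G (σ (π i)) (σ (π (next i))) ≡ false
      loop = trans (cong (λ z → adj G (σ (π i)) (σ z)) (sym eq)) (irrefl G _)

  module Automorphism {φ : Fin n → Fin n} (aut : IsAut G φ) where

    π : Fin n → Fin n
    π i = position (φ (σ i))

    φ∘σ : ∀ i → φ (σ i) ≡ σ (π i)
    φ∘σ i = sym (σ-position _)

    φ-via-π : ∀ v → φ v ≡ σ (π (position v))
    φ-via-π v = trans (cong φ (sym (σ-position v))) (φ∘σ _)

    π-injective : Injective _≡_ _≡_ π
    π-injective {i} {j} e = bij (proj₁ aut (trans (φ∘σ i) (trans (cong σ e) (sym (φ∘σ j)))))

    π-edge : ∀ j → adj G (σ (π j)) (σ (π (next j))) ≡ true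
    π-edge j = trans (sym (cong₂ (adj G) (φ∘σ j) (φ∘σ (next j)))) (trans (proj₂ aut _ _) (cycle-edge j))

    rotation-or-reflection-on-positions : Rotation π ⊎ Reflection π
    rotation-or-reflection-on-positions = rotation-or-reflection π π-injective (CycleMap.image-of-next π π-injective π-edge)

    fixes⇒π-fixes : ∀ {x} → φ x ≡ x → π (position x) ≡ position x
    fixes⇒π-fixes {x} φx≡x = bij (trans (sym (φ-via-π x)) (trans φx≡x (sym (σ-position x))))

    reflection⇒IsReflection : Reflection π → NonIdentity φ → IsReflection G σ φ
    reflection⇒IsReflection ref nonid =
      aut , nonid , toℕ (π zero) , toℕ<n (π zero) ,
      λ i j i+j≡k → trans (φ∘σ i) (cong σ (SumsTo-functional (reflection-sum ref i) i+j≡k))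

  nonidentity-fixing⇒reflection : ∀ {x φ} (aut : IsAut G φ) → NonIdentity φ → φ x ≡ x →
                                  Reflection (Automorphism.π aut)
  nonidentity-fixing⇒reflection aut (v , φv≢v) φx≡x with Automorphism.rotation-or-reflection-on-positions aut
  ... | inj₂ ref = ref
  ... | inj₁ rot = ⊥-elim (φv≢v (trans (φ-via-π v) (trans (cong σ (π≗id (position v))) (σ-position v))))
    where
    open Automorphism aut
    π≗id : ∀ i → π i ≡ i
    π≗id = rotation-fixing-point⇒identity rot _ (fixes⇒π-fixes φx≡x)

  FixingAut⇒IsReflection : ∀ {x φ} → FixingAut G x φ → IsReflection G σ φ
  FixingAut⇒IsReflection (aut , nonid , φx≡x) =
    Automorphism.reflection⇒IsReflection aut (nonidentity-fixing⇒reflection aut nonid φx≡x) nonid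

  FixingAut-unique : ∀ {u φ ψ} → FixingAut G u φ → FixingAut G u ψ → ∀ z → φ z ≡ ψ z
  FixingAut-unique {u} {φ} {ψ} (aut , nonid , φu≡u) (aut′ , nonid′ , ψu≡u) z = begin
    φ z                 ≡⟨ φ-via-π z ⟩
    σ (π (position z))  ≡⟨ cong σ (reflections-agreeing-at-point-agree ref ref′ (position u) same-at-u (position z)) ⟩
    σ (π′ (position z)) ≡⟨ φ-via-π′ z ⟨
    ψ z                 ∎
    where
    open Automorphism aut
    open Automorphism aut′ renaming (π to π′; φ-via-π to φ-via-π′; fixes⇒π-fixes to fixes⇒π′-fixes)
    ref  = nonidentity-fixing⇒reflection aut nonid φu≡u
    ref′ = nonidentity-fixing⇒reflection aut′ nonid′ ψu≡u
    same-at-u : π (position u) ≡ π′ (position u)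
    same-at-u = trans (fixes⇒π-fixes φu≡u) (sym (fixes⇒π′-fixes ψu≡u))

  ¬FixingAut⇒MovedByAllReflections : ∀ {x} → ¬ ∃ (FixingAut G x) → MovedByAllReflections G σ x
  ¬FixingAut⇒MovedByAllReflections ¬fixing φ (aut , nonid , _) φx≡x = ¬fixing (φ , aut , nonid , φx≡x)

  ⁅moved⁆-determining : ∀ {x} → MovedByAllReflections G σ x → Determining G ⁅ x ⁆
  ⁅moved⁆-determining {x} moved χ aut fixes v with χ v ≟ v
  ... | yes χv≡v = χv≡v
  ... | no χv≢v  = ⊥-elim (moved χ (FixingAut⇒IsReflection (aut , (v , χv≢v) , χx≡x)) χx≡x)
    where
    χx≡x = fixes x (x∈⁅x⁆ x)

  ⁅fixed⁆∪⁅fixed⁆-determining : ∀ {u v} → FixedByDifferentReflections G σ u v →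
                                Determining G (⁅ u ⁆ ∪ ⁅ v ⁆)
  ⁅fixed⁆∪⁅fixed⁆-determining {u} {v}
    (_ , φ , ψ , (aut , nonid , _) , (aut′ , nonid′ , _) , (w , φw≢ψw) , φu≡u , ψv≡v) χ autχ fixes z
    with χ z ≟ z
  ... | yes χz≡z = χz≡z
  ... | no χz≢z  = ⊥-elim (φw≢ψw (begin
    φ w ≡⟨ FixingAut-unique (aut , nonid , φu≡u) (autχ , (z , χz≢z) , χu≡u) w ⟩
    χ w ≡⟨ FixingAut-unique (autχ , (z , χz≢z) , χv≡v) (aut′ , nonid′ , ψv≡v) w ⟩
    ψ w ∎))
    where
    χu≡u = fixes u (x∈p∪q⁺ (inj₁ (x∈⁅x⁆ u)))
    χv≡v = fixes v (x∈p∪q⁺ {p = ⁅ u ⁆} (inj₂ (x∈⁅x⁆ v)))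

  moved⇒minimal-determining : NontrivialAut G → ∀ x → MovedByAllReflections G σ x → MinimalDetermining G ⁅ x ⁆
  moved⇒minimal-determining (_ , aut , nonid) x moved =
    ⁅moved⁆-determining moved ,
    λ T T⊂⁅x⁆ → nonidentity-fixing⇒¬Determining G aut nonid (λ v v∈T → ⊥-elim (⊂⁅⁆⇒empty T⊂⁅x⁆ v v∈T))

  fixed⇒minimal-determining : ∀ u v → FixedByDifferentReflections G σ u v → MinimalDetermining G (⁅ u ⁆ ∪ ⁅ v ⁆)
  fixed⇒minimal-determining u v fixed@(_ , _ , _ , (aut , nonid , _) , (aut′ , nonid′ , _) , _ , φu≡u , ψv≡v) =
    ⁅fixed⁆∪⁅fixed⁆-determining fixed ,
    λ T T⊂ → [ (λ (T⊆⁅u⁆ : T ⊆ ⁅ u ⁆) → nonidentity-fixing⇒¬Determining G aut nonid (fixes-⊆⁅⁆ φu≡u T⊆⁅u⁆))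
             , (λ (T⊆⁅v⁆ : T ⊆ ⁅ v ⁆) → nonidentity-fixing⇒¬Determining G aut′ nonid′ (fixes-⊆⁅⁆ ψv≡v T⊆⁅v⁆)) ]
             (⊂⁅⁆∪⁅⁆ T⊂)

  minimal-determining-classification :
    NontrivialAut G → ∀ S → MinimalDetermining G S →
    (∃[ x ] (MovedByAllReflections G σ x × S ≡ ⁅ x ⁆))
    ⊎ (∃[ u ] ∃[ v ] (FixedByDifferentReflections G σ u v × S ≡ ⁅ u ⁆ ∪ ⁅ v ⁆))
  minimal-determining-classification (_ , aut₀ , nonid₀) S min@(det , _)
    with Determining⇒moved-member G det aut₀ nonid₀
  ... | x , x∈S , _ with ∃FixingAut? G x
  ...   | no ¬fixing = inj₁ (x , moved , minimal-determining-⊇⇒≡ G min (⁅⁆⊆ x∈S) (⁅moved⁆-determining moved))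
    where moved = ¬FixingAut⇒MovedByAllReflections ¬fixing
  ...   | yes (φ , fixing@(aut , nonid , φx≡x)) with Determining⇒moved-member G det aut nonid
  ...     | y , y∈S , φy≢y with ∃FixingAut? G y
  ...       | no ¬fixing = inj₁ (y , moved , minimal-determining-⊇⇒≡ G min (⁅⁆⊆ y∈S) (⁅moved⁆-determining moved))
    where moved = ¬FixingAut⇒MovedByAllReflections ¬fixing
  ...       | yes (ψ , fixing′@(_ , _ , ψy≡y)) =
    inj₂ (x , y , fixed , minimal-determining-⊇⇒≡ G min (⁅⁆∪⁅⁆⊆ x∈S y∈S) (⁅fixed⁆∪⁅fixed⁆-determining fixed))
    where
    fixed : FixedByDifferentReflections G σ x y
    fixed = (λ { refl → φy≢y φx≡x }) , φ , ψ , FixingAut⇒IsReflection fixing , FixingAut⇒IsReflection fixing′ ,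
            (y , λ φy≡ψy → φy≢y (trans φy≡ψy ψy≡y)) , φx≡x , ψy≡y

corollary19 : (n : ℕ) (G : Graph n) (σ : Fin n → Fin n) →
    OuterplanarHamiltonian G σ → NontrivialAut G →
    (∀ x → MovedByAllReflections G σ x → MinimalDetermining G ⁅ x ⁆)
    × (∀ u v → FixedByDifferentReflections G σ u v → MinimalDetermining G (⁅ u ⁆ ∪ ⁅ v ⁆))
    × (∀ S → MinimalDetermining G S →
         (∃[ x ] (MovedByAllReflections G σ x × S ≡ ⁅ x ⁆))
         ⊎ (∃[ u ] ∃[ v ] (FixedByDifferentReflections G σ u v × S ≡ ⁅ u ⁆ ∪ ⁅ v ⁆)))
corollary19 zero       G σ H _ with () ← OuterplanarHamiltonian.atLeastTwo H
corollary19 (suc zero) G σ H _ with ℕ.s≤s () ← OuterplanarHamiltonian.atLeastTwo H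
corollary19 (suc (suc m)) G σ H nontrivial =
  moved⇒minimal-determining nontrivial , fixed⇒minimal-determining , minimal-determining-classification nontrivial
  where open Outerplanar H
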